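{- Let $\mathbf A$ be a residuated ortholattice. Then for all $x,y\in A$: (1) $\neg x\le x\backslash y$; (2) $\neg(x\backslash y)\le x\le(\neg x)\backslash y$; (3) $(x\backslash y)x=x\wedge (x\backslash y)=x(x\backslash y)$; (4) $x\wedge (x\backslash y)\le y$; (5) $x\backslash(x\wedge y)=x\backslash y$; (6) $xy=x(yx)$; (7) $xy=0$ if and only if $yx=0$.
   Context: A residuated ortholattice is an algebra $(A,\wedge,\vee,\neg,\backslash,0,1)$ where $(A,\wedge,\vee,0,1)$ is a bounded lattice, $\neg$ is an order-reversing involution, and $x\cdot y\le z\iff y\le x\backslash z$ for all $x,y,z$, where $xy=x\cdot y:=x\wedge(\neg x\vee y)$ is the Sasaki product. -}

module Defs where

open import Level using (Level; suc; _⊔_)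
open import Algebra.Lattice.Bundles using (Lattice)
open import Algebra.Core using (Op₁; Op₂)
open import Algebra.Definitions using (Congruent₁; Congruent₂)
open import Data.Product using (_×_)

-- The order is the lattice order  x ≤ y :⇔ x ∧ y ≈ x.
-- ¬ and \ are required to be congruences for the setoid equality ≈
-- (automatic for an algebra whose equality is actual equality).
record ResiduatedOrtholattice c ℓ : Set (suc (c ⊔ ℓ)) where
  infix  8 ¬_
  infixl 7 _\\_ _·_
  infix  4 _≤_
  field
    lattice : Lattice c ℓ
  open Lattice lattice public
  field
    ¬_  : Op₁ Carrier
    _\\_ : Op₂ Carrier
    𝟘   : Carrier
    𝟙   : Carrier

  _≤_ : Carrier → Carrier → Set ℓ
  x ≤ y = (x ∧ y) ≈ x

  _·_ : Op₂ Carrier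
  x · y = x ∧ (¬ x ∨ y)

  field
    ¬-cong    : Congruent₁ _≈_ ¬_
    \\-cong    : Congruent₂ _≈_ _\\_
    𝟘-least   : ∀ x → 𝟘 ≤ x
    𝟙-greatest : ∀ x → x ≤ 𝟙
    ¬-antitone : ∀ x y → x ≤ y → ¬ y ≤ ¬ x
    ¬-involutive : ∀ x → ¬ ¬ x ≈ x
    residuated₁ : ∀ x y z → x · y ≤ z → y ≤ x \\ z
    residuated₂ : ∀ x y z → y ≤ x \\ z → x · y ≤ z

{-# OPTIONS --safe #-}
module Submission where

open import Defs
open import Data.Product using (_×_; _,_)
open import Function.Bundles using (_⇔_; mk⇔)
open import Relation.Binary.Bundles using (Poset)
import Algebra.Lattice.Properties.Lattice as LatticeProperties
import Relation.Binary.Lattice as OrderTheoretic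
import Relation.Binary.Reasoning.PartialOrder as PosetReasoning

-- Everything rests on two consequences of residuation: x · 𝟘 = x ∧ ¬ x is the
-- least element, and x · _ preserves joins (being a left adjoint). For (6) the crucial estimate is
-- x · y ≤ y · x ∨ ¬ x, obtained by enlarging x to t = x ∨ ¬ y: since ¬ t ≤ y
-- and ¬ t ≤ ¬ x, the Sasaki products t · y and t · ¬ x collapse to meets.
-- Then (7) follows from (6) and x · 𝟘 = 𝟘.
module ResiduatedOrtholatticeProperties {c ℓ} (A : ResiduatedOrtholattice c ℓ) where
  open ResiduatedOrtholattice A

  private
    module O = OrderTheoretic.Lattice
      (LatticeProperties.∨-∧-orderTheoreticLattice lattice)

    -- the library's lattice order is x ≈ x ∧ y, the mirror image of ours
    fromO : ∀ {x y} → x O.≤ y → x ≤ y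
    fromO = sym

    toO : ∀ {x y} → x ≤ y → x O.≤ y
    toO = sym

  ≤-reflexive : ∀ {x y} → x ≈ y → x ≤ y
  ≤-reflexive x≈y = fromO (O.reflexive x≈y)

  ≤-refl : ∀ {x} → x ≤ x
  ≤-refl = ≤-reflexive refl

  ≤-trans : ∀ {x y z} → x ≤ y → y ≤ z → x ≤ z
  ≤-trans x≤y y≤z = fromO (O.trans (toO x≤y) (toO y≤z))

  ≤-antisym : ∀ {x y} → x ≤ y → y ≤ x → x ≈ y
  ≤-antisym x≤y y≤x = O.antisym (toO x≤y) (toO y≤x)

  poset : Poset c ℓ ℓ
  poset = record
    { _≈_ = _≈_
    ; _≤_ = _≤_
    ; isPartialOrder = record
      { isPreorder = record
        { isEquivalence = isEquivalence
        ; reflexive = ≤-reflexive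
        ; trans = ≤-trans
        }
      ; antisym = ≤-antisym
      }
    }

  open PosetReasoning poset

  x≤x∨y : ∀ x y → x ≤ x ∨ y
  x≤x∨y x y = fromO (O.x≤x∨y x y)

  y≤x∨y : ∀ x y → y ≤ x ∨ y
  y≤x∨y x y = fromO (O.y≤x∨y x y)

  ∨-least : ∀ {x y z} → x ≤ z → y ≤ z → x ∨ y ≤ z
  ∨-least x≤z y≤z = fromO (O.∨-least (toO x≤z) (toO y≤z))

  x∧y≤x : ∀ x y → x ∧ y ≤ x
  x∧y≤x x y = fromO (O.x∧y≤x x y)

  x∧y≤y : ∀ x y → x ∧ y ≤ y
  x∧y≤y x y = fromO (O.x∧y≤y x y)

  ∧-greatest : ∀ {x y z} → z ≤ x → z ≤ y → z ≤ x ∧ y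
  ∧-greatest z≤x z≤y = fromO (O.∧-greatest (toO z≤x) (toO z≤y))

  ∨-mono : ∀ {w x y z} → w ≤ x → y ≤ z → w ∨ y ≤ x ∨ z
  ∨-mono w≤x y≤z = ∨-least (≤-trans w≤x (x≤x∨y _ _)) (≤-trans y≤z (y≤x∨y _ _))

  ∧-mono : ∀ {w x y z} → w ≤ x → y ≤ z → w ∧ y ≤ x ∧ z
  ∧-mono w≤x y≤z = ∧-greatest (≤-trans (x∧y≤x _ _) w≤x) (≤-trans (x∧y≤y _ _) y≤z)

  ¬x≤y⇒¬y≤x : ∀ {x y} → ¬ x ≤ y → ¬ y ≤ x
  ¬x≤y⇒¬y≤x {x} {y} ¬x≤y = begin
    ¬ y     ≤⟨ ¬-antitone _ _ ¬x≤y ⟩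
    ¬ ¬ x   ≈⟨ ¬-involutive x ⟩
    x       ∎

  x·y≤x : ∀ x y → x · y ≤ x
  x·y≤x x y = x∧y≤x x _

  ·-monoʳ : ∀ x {y z} → y ≤ z → x · y ≤ x · z
  ·-monoʳ x y≤z = ∧-mono ≤-refl (∨-mono ≤-refl y≤z)

  x·[y∨z]≤x·y∨x·z : ∀ x y z → x · (y ∨ z) ≤ x · y ∨ x · z
  x·[y∨z]≤x·y∨x·z x y z = residuated₂ x _ _ (∨-least
    (residuated₁ x y _ (x≤x∨y _ _))
    (residuated₁ x z _ (y≤x∨y _ _)))

  ¬x≤y⇒x·y≈x∧y : ∀ {x y} → ¬ x ≤ y → x · y ≈ x ∧ y
  ¬x≤y⇒x·y≈x∧y ¬x≤y = ≤-antisym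
    (∧-mono ≤-refl (∨-least ¬x≤y ≤-refl))
    (∧-mono ≤-refl (y≤x∨y _ _))

  x·𝟘≤y : ∀ x y → x · 𝟘 ≤ y
  x·𝟘≤y x y = residuated₂ x 𝟘 y (𝟘-least _)

  x·¬x≤y : ∀ x y → x · ¬ x ≤ y
  x·¬x≤y x y = begin
    x ∧ (¬ x ∨ ¬ x)   ≤⟨ ∧-mono ≤-refl (∨-least (x≤x∨y _ 𝟘) (x≤x∨y _ 𝟘)) ⟩
    x · 𝟘             ≤⟨ x·𝟘≤y x y ⟩
    y                 ∎

  ¬x≤x\\y : ∀ x y → ¬ x ≤ x \\ y
  ¬x≤x\\y x y = residuated₁ x (¬ x) y (x·¬x≤y x y)

  ¬[x\\y]≤x : ∀ x y → ¬ (x \\ y) ≤ x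
  ¬[x\\y]≤x x y = ¬x≤y⇒¬y≤x (¬x≤x\\y x y)

  x≤¬x\\y : ∀ x y → x ≤ (¬ x) \\ y
  x≤¬x\\y x y = begin
    x             ≈⟨ sym (¬-involutive x) ⟩
    ¬ ¬ x         ≤⟨ ¬x≤x\\y (¬ x) y ⟩
    (¬ x) \\ y    ∎

  [x\\y]·x≈x∧[x\\y] : ∀ x y → (x \\ y) · x ≈ x ∧ (x \\ y)
  [x\\y]·x≈x∧[x\\y] x y = trans (¬x≤y⇒x·y≈x∧y (¬[x\\y]≤x x y)) (∧-comm _ _)

  x∧[x\\y]≈x·[x\\y] : ∀ x y → x ∧ (x \\ y) ≈ x · (x \\ y)
  x∧[x\\y]≈x·[x\\y] x y = sym (¬x≤y⇒x·y≈x∧y (¬x≤x\\y x y))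

  x·[x\\y]≤y : ∀ x y → x · (x \\ y) ≤ y
  x·[x\\y]≤y x y = residuated₂ x _ y ≤-refl

  x∧[x\\y]≤y : ∀ x y → x ∧ (x \\ y) ≤ y
  x∧[x\\y]≤y x y = ≤-trans (≤-reflexive (x∧[x\\y]≈x·[x\\y] x y)) (x·[x\\y]≤y x y)

  x\\[x∧y]≈x\\y : ∀ x y → x \\ (x ∧ y) ≈ x \\ y
  x\\[x∧y]≈x\\y x y = ≤-antisym
    (residuated₁ x _ y (≤-trans (x·[x\\y]≤y x _) (x∧y≤y _ _)))
    (residuated₁ x _ _ (∧-greatest (x·y≤x x _) (x·[x\\y]≤y x y)))

  x·y≤y·x∨¬x : ∀ x y → x · y ≤ y · x ∨ ¬ x
  x·y≤y·x∨¬x x y = begin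
    x · y              ≤⟨ ∧-mono (x≤x∨y x (¬ y)) ¬x∨y≤¬t∨[y∨¬x] ⟩
    t · (y ∨ ¬ x)      ≤⟨ x·[y∨z]≤x·y∨x·z t y (¬ x) ⟩
    t · y ∨ t · ¬ x    ≈⟨ ∨-cong (¬x≤y⇒x·y≈x∧y ¬t≤y) (¬x≤y⇒x·y≈x∧y ¬t≤¬x) ⟩
    t ∧ y ∨ t ∧ ¬ x    ≤⟨ ∨-mono (≤-reflexive t∧y≈y·x) (x∧y≤y t (¬ x)) ⟩
    y · x ∨ ¬ x        ∎
    where
    t = x ∨ ¬ y
    ¬t≤y : ¬ t ≤ y
    ¬t≤y = ¬x≤y⇒¬y≤x (y≤x∨y x (¬ y))
    ¬t≤¬x : ¬ t ≤ ¬ x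
    ¬t≤¬x = ¬-antitone _ _ (x≤x∨y x (¬ y))
    ¬x∨y≤¬t∨[y∨¬x] : ¬ x ∨ y ≤ ¬ t ∨ (y ∨ ¬ x)
    ¬x∨y≤¬t∨[y∨¬x] = ≤-trans (≤-reflexive (∨-comm (¬ x) y)) (y≤x∨y (¬ t) _)
    t∧y≈y·x : t ∧ y ≈ y · x
    t∧y≈y·x = trans (∧-comm t y) (∧-cong refl (∨-comm x (¬ y)))

  x·y≈x·[y·x] : ∀ x y → x · y ≈ x · (y · x)
  x·y≈x·[y·x] x y = ≤-antisym
    (∧-greatest (x·y≤x x y)
      (≤-trans (x·y≤y·x∨¬x x y) (≤-reflexive (∨-comm _ _))))
    (·-monoʳ x (x·y≤x y x))

  x·y≈𝟘⇒y·x≈𝟘 : ∀ {x y} → x · y ≈ 𝟘 → y · x ≈ 𝟘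
  x·y≈𝟘⇒y·x≈𝟘 {x} {y} x·y≈𝟘 = ≤-antisym y·x≤𝟘 (𝟘-least _)
    where
    y·x≤𝟘 : y · x ≤ 𝟘
    y·x≤𝟘 = begin
      y · x         ≈⟨ x·y≈x·[y·x] y x ⟩
      y · (x · y)   ≤⟨ ·-monoʳ y (≤-reflexive x·y≈𝟘) ⟩
      y · 𝟘         ≤⟨ x·𝟘≤y y 𝟘 ⟩
      𝟘             ∎

lemma4p1 : ∀ {c ℓ} (A : ResiduatedOrtholattice c ℓ) → let open ResiduatedOrtholattice A in
    ∀ x y →
      (¬ x ≤ x \\ y)
      × ((¬ (x \\ y) ≤ x) × (x ≤ (¬ x) \\ y))
      × (((x \\ y) · x ≈ x ∧ (x \\ y)) × (x ∧ (x \\ y) ≈ x · (x \\ y)))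
      × (x ∧ (x \\ y) ≤ y)
      × (x \\ (x ∧ y) ≈ x \\ y)
      × (x · y ≈ x · (y · x))
      × ((x · y ≈ 𝟘) ⇔ (y · x ≈ 𝟘))
lemma4p1 A x y =
  ¬x≤x\\y x y
  , (¬[x\\y]≤x x y , x≤¬x\\y x y)
  , ([x\\y]·x≈x∧[x\\y] x y , x∧[x\\y]≈x·[x\\y] x y)
  , x∧[x\\y]≤y x y
  , x\\[x∧y]≈x\\y x y
  , x·y≈x·[y·x] x y
  , mk⇔ x·y≈𝟘⇒y·x≈𝟘 x·y≈𝟘⇒y·x≈𝟘
  where open ResiduatedOrtholatticeProperties A
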